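{- Let $P_n$ be the path graph with vertex set $\{1,2,\ldots,n\}$ and edges $\{i,i+1\}$ ($1\le i\le n-1$), where $n>2$. Let $A\subseteq\{1,\ldots,n\}$ be nonempty, and put $a=\min A-1$ and $b=\max A-\min A+1$. Then $$W_{\rho_A}(P_n)=\frac12\Big(n^3-n^2+\tfrac13 b(2b-1)(b-1)-2a(n-b-a)(n+b-1)\Big).$$
   Context: For a graph $G$, $A\subseteq V_G$ and $u,v\in V_G$, $\rho_A(u,v)$ is the minimum length of a walk in $G$ from $u$ to $v$ (vertex repetitions allowed, length $\ge0$) visiting every vertex of $A$, and $W_{\rho_A}(G)=\frac12\sum_{u,v\in V_G}\rho_A(u,v)$, the sum being over all ordered pairs $(u,v)$, including $u=v$. -}

module Defs where

open import Data.Nat using (ℕ; zero; suc; _+_; _≤_)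
open import Data.Fin using (Fin; toℕ)
open import Data.Fin.Subset using (Subset; _∈_)
open import Data.Product using (Σ; _×_)
open import Relation.Binary.PropositionalEquality using (_≡_)

-- Path graph P_n : vertex i : Fin n stands for the vertex (toℕ i + 1) ∈ {1,…,n};
-- edges {i, i+1}.
Adj : ∀ {n} → Fin n → Fin n → Set
Adj i j = (toℕ j ≡ suc (toℕ i)) ⊎' (toℕ i ≡ suc (toℕ j))
  where
  open import Data.Sum using () renaming (_⊎_ to _⊎'_)

data Walk {n : ℕ} : Fin n → Fin n → Set where
  stay : (u : Fin n) → Walk u u
  step : ∀ {u w v} → Adj u w → Walk w v → Walk u v

len : ∀ {n} {u v : Fin n} → Walk u v → ℕ
len (stay _)   = 0
len (step _ p) = suc (len p)

data OnWalk {n : ℕ} (x : Fin n) : {u v : Fin n} → Walk u v → Set where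
  here-stay : OnWalk x (stay x)
  here-step : ∀ {w v} (e : Adj x w) (p : Walk w v) → OnWalk x (step e p)
  there     : ∀ {u w v} (e : Adj u w) {p : Walk w v} → OnWalk x p → OnWalk x (step e p)

VisitsAll : ∀ {n} → Subset n → {u v : Fin n} → Walk u v → Set
VisitsAll A p = ∀ x → x ∈ A → OnWalk x p

IsRho : ∀ {n} → Subset n → Fin n → Fin n → ℕ → Set
IsRho A u v k =
  Σ (Walk u v) (λ p → VisitsAll A p × len p ≡ k)
  × (∀ (p : Walk u v) → VisitsAll A p → k ≤ len p)

sumFin : ∀ n → (Fin n → ℕ) → ℕ
sumFin zero    f = 0
sumFin (suc n) f = f Fin.zero + sumFin n (λ i → f (Fin.suc i))

-- sum over all ordered pairs (u,v), including u = v  (this is 2 · W_ρA(P_n))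
sumPairs : ∀ n → (Fin n → Fin n → ℕ) → ℕ
sumPairs n ρ = sumFin n (λ u → sumFin n (λ v → ρ u v))

module Submission where

-- A walk through A must pass through m = min A and M = max A, and on a path a walk from x to y
-- has length at least |x − y|; so ρ_A(u,v) is the length of the shorter of the tours
-- u → m → M → v and u → M → m → v, both of which are realised because A ⊆ [m, M].
-- The sum of these tour lengths is computed by induction on the number of vertices outside
-- [m, M]: appending a vertex on the right (when m = 0) or prepending one on the left changes
-- the sum by an explicit polynomial, and the base case [m, M] = [0, n − 1] follows from
-- tour(u,v) + |u − v| = 2(n − 1) together with Σ|u − v| = (n³ − n)/3.

module Sums where

  open import Data.Nat
  open import Data.Nat.Properties
  open import Data.Nat.Tactic.RingSolver using (solve-∀)
  open import Algebra.Properties.CommutativeSemigroup +-commutativeSemigroup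
    using () renaming (interchange to +-interchange)
  open import Relation.Binary.PropositionalEquality
  open ≡-Reasoning

  sumBelow : ℕ → (ℕ → ℕ) → ℕ
  sumBelow zero    f = 0
  sumBelow (suc n) f = f 0 + sumBelow n (λ i → f (suc i))

  sumBelow-cong : ∀ n {f g : ℕ → ℕ} → (∀ i → i < n → f i ≡ g i) → sumBelow n f ≡ sumBelow n g
  sumBelow-cong zero    f≡g = refl
  sumBelow-cong (suc n) f≡g = cong₂ _+_ (f≡g 0 z<s) (sumBelow-cong n (λ i i<n → f≡g (suc i) (s<s i<n)))

  sumBelow-init-last : ∀ n f → sumBelow (suc n) f ≡ sumBelow n f + f n
  sumBelow-init-last zero    f = +-comm (f 0) 0
  sumBelow-init-last (suc n) f = begin
    f 0 + sumBelow (suc n) (λ i → f (suc i))    ≡⟨ cong (f 0 +_) (sumBelow-init-last n (λ i → f (suc i))) ⟩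
    f 0 + (sumBelow n (λ i → f (suc i)) + f (suc n)) ≡⟨ +-assoc (f 0) _ _ ⟨
    f 0 + sumBelow n (λ i → f (suc i)) + f (suc n) ∎

  sumBelow-distrib-+ : ∀ n f g → sumBelow n (λ i → f i + g i) ≡ sumBelow n f + sumBelow n g
  sumBelow-distrib-+ zero    f g = refl
  sumBelow-distrib-+ (suc n) f g = begin
    f 0 + g 0 + sumBelow n (λ i → f (suc i) + g (suc i))
      ≡⟨ cong (f 0 + g 0 +_) (sumBelow-distrib-+ n (λ i → f (suc i)) (λ i → g (suc i))) ⟩
    f 0 + g 0 + (sumBelow n (λ i → f (suc i)) + sumBelow n (λ i → g (suc i)))
      ≡⟨ +-interchange (f 0) (g 0) _ _ ⟩
    f 0 + sumBelow n (λ i → f (suc i)) + (g 0 + sumBelow n (λ i → g (suc i))) ∎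

  sumBelow-const : ∀ n c → sumBelow n (λ _ → c) ≡ n * c
  sumBelow-const zero    c = refl
  sumBelow-const (suc n) c = cong (c +_) (sumBelow-const n c)

  sumBelow-suc : ∀ n → sumBelow n suc ≡ n + sumBelow n (λ i → i)
  sumBelow-suc n = begin
    sumBelow n (λ i → 1 + i)                    ≡⟨ sumBelow-distrib-+ n (λ _ → 1) (λ i → i) ⟩
    sumBelow n (λ _ → 1) + sumBelow n (λ i → i) ≡⟨ cong (_+ sumBelow n (λ i → i)) (trans (sumBelow-const n 1) (*-identityʳ n)) ⟩
    n + sumBelow n (λ i → i)                    ∎

  2*sumBelow-id+n≡n*n : ∀ n → 2 * sumBelow n (λ i → i) + n ≡ n * n
  2*sumBelow-id+n≡n*n zero    = refl
  2*sumBelow-id+n≡n*n (suc n) = begin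
    2 * sumBelow n suc + suc n  ≡⟨ cong (λ s → 2 * s + suc n) (sumBelow-suc n) ⟩
    2 * (n + t) + suc n         ≡⟨ rearrange n t ⟩
    (2 * t + n) + (2 * n + 1)   ≡⟨ cong (_+ (2 * n + 1)) (2*sumBelow-id+n≡n*n n) ⟩
    n * n + (2 * n + 1)         ≡⟨ suc-square n ⟩
    suc n * suc n               ∎
    where
    t = sumBelow n (λ i → i)
    rearrange : ∀ n t → 2 * (n + t) + suc n ≡ (2 * t + n) + (2 * n + 1)
    rearrange = solve-∀
    suc-square : ∀ n → n * n + (2 * n + 1) ≡ suc n * suc n
    suc-square = solve-∀

  sumPairsBelow : ℕ → (ℕ → ℕ → ℕ) → ℕ
  sumPairsBelow n f = sumBelow n (λ u → sumBelow n (f u))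

  sumPairsBelow-cong : ∀ n {f g : ℕ → ℕ → ℕ} → (∀ u v → u < n → v < n → f u v ≡ g u v) →
                       sumPairsBelow n f ≡ sumPairsBelow n g
  sumPairsBelow-cong n f≡g = sumBelow-cong n (λ u u<n → sumBelow-cong n (λ v v<n → f≡g u v u<n v<n))

  sumPairsBelow-distrib-+ : ∀ n f g →
    sumPairsBelow n (λ u v → f u v + g u v) ≡ sumPairsBelow n f + sumPairsBelow n g
  sumPairsBelow-distrib-+ n f g = begin
    sumBelow n (λ u → sumBelow n (λ v → f u v + g u v))
      ≡⟨ sumBelow-cong n (λ u _ → sumBelow-distrib-+ n (f u) (g u)) ⟩
    sumBelow n (λ u → sumBelow n (f u) + sumBelow n (g u))
      ≡⟨ sumBelow-distrib-+ n (λ u → sumBelow n (f u)) (λ u → sumBelow n (g u)) ⟩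
    sumPairsBelow n f + sumPairsBelow n g ∎

  sumPairsBelow-init-last : ∀ n f → sumPairsBelow (suc n) f ≡
    sumPairsBelow n f + sumBelow n (f n) + (sumBelow n (λ u → f u n) + f n n)
  sumPairsBelow-init-last n f = begin
    sumBelow (suc n) (λ u → sumBelow (suc n) (f u))
      ≡⟨ sumBelow-cong (suc n) (λ u _ → sumBelow-init-last n (f u)) ⟩
    sumBelow (suc n) (λ u → sumBelow n (f u) + f u n)
      ≡⟨ sumBelow-distrib-+ (suc n) (λ u → sumBelow n (f u)) (λ u → f u n) ⟩
    sumBelow (suc n) (λ u → sumBelow n (f u)) + sumBelow (suc n) (λ u → f u n)
      ≡⟨ cong₂ _+_ (sumBelow-init-last n (λ u → sumBelow n (f u))) (sumBelow-init-last n (λ u → f u n)) ⟩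
    sumPairsBelow n f + sumBelow n (f n) + (sumBelow n (λ u → f u n) + f n n) ∎

  sumPairsBelow-suc : ∀ n f → sumPairsBelow (suc n) f ≡
    f 0 0 + sumBelow n (λ v → f 0 (suc v))
      + (sumBelow n (λ u → f (suc u) 0) + sumPairsBelow n (λ u v → f (suc u) (suc v)))
  sumPairsBelow-suc n f =
    cong (f 0 0 + sumBelow n (λ v → f 0 (suc v)) +_)
      (sumBelow-distrib-+ n (λ u → f (suc u) 0) (λ u → sumBelow n (λ v → f (suc u) (suc v))))

  distancesFrom : ℕ → ℕ → ℕ
  distancesFrom u n = sumBelow n (λ v → ∣ u - v ∣)

  3*∑∣u-v∣+n≡n*n*n : ∀ n → 3 * sumPairsBelow n (λ u v → ∣ u - v ∣) + n ≡ n * n * n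
  3*∑∣u-v∣+n≡n*n*n zero    = refl
  3*∑∣u-v∣+n≡n*n*n (suc n) = begin
    3 * (sumBelow n suc + sumBelow n (λ u → suc u + distancesFrom u n)) + suc n
      ≡⟨ cong (λ x → 3 * (sumBelow n suc + x) + suc n) (sumBelow-distrib-+ n suc (λ u → distancesFrom u n)) ⟩
    3 * (sumBelow n suc + (sumBelow n suc + D)) + suc n
      ≡⟨ cong (λ x → 3 * (x + (x + D)) + suc n) (sumBelow-suc n) ⟩
    3 * (n + t + (n + t + D)) + suc n
      ≡⟨ rearrange n t D ⟩
    (3 * D + n) + 3 * (2 * t + n) + (1 + 3 * n)
      ≡⟨ cong₂ (λ x y → x + 3 * y + (1 + 3 * n)) (3*∑∣u-v∣+n≡n*n*n n) (2*sumBelow-id+n≡n*n n) ⟩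
    n * n * n + 3 * (n * n) + (1 + 3 * n)
      ≡⟨ suc-cube n ⟩
    suc n * suc n * suc n ∎
    where
    t = sumBelow n (λ i → i)
    D = sumPairsBelow n (λ u v → ∣ u - v ∣)
    rearrange : ∀ n t d → 3 * (n + t + (n + t + d)) + suc n ≡ (3 * d + n) + 3 * (2 * t + n) + (1 + 3 * n)
    rearrange = solve-∀
    suc-cube : ∀ n → n * n * n + 3 * (n * n) + (1 + 3 * n) ≡ suc n * suc n * suc n
    suc-cube = solve-∀

  2*distancesFrom≡q*[1+q]+c*[1+c] : ∀ q c → 2 * distancesFrom q (suc (q + c)) ≡ q * suc q + c * suc c
  2*distancesFrom≡q*[1+q]+c*[1+c] zero    c = +-cancelʳ-≡ (suc c) _ _ (begin
    2 * sumBelow (suc c) (λ i → i) + suc c ≡⟨ 2*sumBelow-id+n≡n*n (suc c) ⟩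
    suc c * suc c                          ≡⟨ rearrange c ⟩
    0 * suc 0 + c * suc c + suc c          ∎)
    where
    rearrange : ∀ c → suc c * suc c ≡ 0 * suc 0 + c * suc c + suc c
    rearrange = solve-∀
  2*distancesFrom≡q*[1+q]+c*[1+c] (suc q) c = begin
    2 * (suc q + distancesFrom q (suc (q + c)))     ≡⟨ *-distribˡ-+ 2 (suc q) _ ⟩
    2 * suc q + 2 * distancesFrom q (suc (q + c))   ≡⟨ cong (2 * suc q +_) (2*distancesFrom≡q*[1+q]+c*[1+c] q c) ⟩
    2 * suc q + (q * suc q + c * suc c)             ≡⟨ rearrange q c ⟩
    suc q * suc (suc q) + c * suc c                 ∎
    where
    rearrange : ∀ q c → 2 * suc q + (q * suc q + c * suc c) ≡ suc q * suc (suc q) + c * suc c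
    rearrange = solve-∀

module Tours where

  open import Data.Nat
  open import Data.Nat.Properties
  open import Data.Nat.Tactic.RingSolver using (solve-∀)
  open import Data.Product using (_,_)
  open import Data.Sum using (inj₁; inj₂)
  open import Relation.Binary.PropositionalEquality
  open Sums

  tour : ℕ → ℕ → ℕ → ℕ → ℕ
  tour m M u v = (∣ u - m ∣ + ∣ m - M ∣ + ∣ M - v ∣) ⊓ (∣ u - M ∣ + ∣ M - m ∣ + ∣ m - v ∣)

  tourSum : ℕ → ℕ → ℕ → ℕ
  tourSum m M n = sumPairsBelow n (tour m M)

  tour-sym : ∀ m M u v → tour m M u v ≡ tour m M v u
  tour-sym m M u v = trans (cong₂ _⊓_ (reverse-route u m M v) (reverse-route u M m v)) (⊓-comm _ _)
    where
    reverse-route : ∀ a b c d → ∣ a - b ∣ + ∣ b - c ∣ + ∣ c - d ∣ ≡ ∣ d - c ∣ + ∣ c - b ∣ + ∣ b - a ∣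
    reverse-route a b c d rewrite ∣-∣-comm a b | ∣-∣-comm b c | ∣-∣-comm c d = +-comm-3 ∣ b - a ∣ ∣ c - b ∣ ∣ d - c ∣
      where
      +-comm-3 : ∀ x y z → x + y + z ≡ z + y + x
      +-comm-3 = solve-∀

  m+∣m-M∣≡M : ∀ {m M} → m ≤ M → m + ∣ m - M ∣ ≡ M
  m+∣m-M∣≡M {m} m≤M = trans (cong (m +_) (m≤n⇒∣m-n∣≡n∸m m≤M)) (m+[n∸m]≡n m≤M)

  tour-from-0 : ∀ {m M} v → m ≤ M → tour m M 0 v ≡ M + ∣ M - v ∣
  tour-from-0 {m} {M} v m≤M = trans (m≤n⇒m⊓n≡m via-m≤via-M) via-m
    where
    open ≤-Reasoning
    via-m : m + ∣ m - M ∣ + ∣ M - v ∣ ≡ M + ∣ M - v ∣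
    via-m = cong (_+ ∣ M - v ∣) (m+∣m-M∣≡M m≤M)
    via-m≤via-M : m + ∣ m - M ∣ + ∣ M - v ∣ ≤ M + ∣ M - m ∣ + ∣ m - v ∣
    via-m≤via-M = begin
      m + ∣ m - M ∣ + ∣ M - v ∣    ≡⟨ via-m ⟩
      M + ∣ M - v ∣                ≤⟨ +-monoʳ-≤ M (∣-∣-triangle M m v) ⟩
      M + (∣ M - m ∣ + ∣ m - v ∣)  ≡⟨ +-assoc M _ _ ⟨
      M + ∣ M - m ∣ + ∣ m - v ∣    ∎

  tour-0-to : ∀ {M v} u → M ≤ v → tour 0 M u v ≡ u + v
  tour-0-to {M} {v} u M≤v = trans (m≤n⇒m⊓n≡m via-0≤via-M) (trans via-0 (cong (_+ v) (∣-∣-identityʳ u)))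
    where
    open ≤-Reasoning
    via-0 : ∣ u - 0 ∣ + M + ∣ M - v ∣ ≡ ∣ u - 0 ∣ + v
    via-0 = trans (+-assoc ∣ u - 0 ∣ M _) (cong (∣ u - 0 ∣ +_) (m+∣m-M∣≡M M≤v))
    via-0≤via-M : ∣ u - 0 ∣ + M + ∣ M - v ∣ ≤ ∣ u - M ∣ + ∣ M - 0 ∣ + v
    via-0≤via-M = begin
      ∣ u - 0 ∣ + M + ∣ M - v ∣    ≡⟨ via-0 ⟩
      ∣ u - 0 ∣ + v                ≤⟨ +-monoˡ-≤ v (∣-∣-triangle u M 0) ⟩
      ∣ u - M ∣ + ∣ M - 0 ∣ + v    ∎

  tour-inside-≤ : ∀ {k u v} → u ≤ v → v ≤ k → tour 0 k u v + ∣ u - v ∣ ≡ 2 * k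
  tour-inside-≤ {u = u} u≤v v≤k with m≤n⇒∃[o]m+o≡n u≤v | m≤n⇒∃[o]m+o≡n v≤k
  ... | q , refl | p , refl
    rewrite ∣-∣-identityʳ u | ∣-∣-identityʳ (u + q + p) | ∣m-m+n∣≡n u q
          | ∣-∣-comm (u + q + p) (u + q) | ∣m-m+n∣≡n (u + q) p
          | +-assoc u q p | ∣m-m+n∣≡n u (q + p)
    = trans (cong (_+ q) (m≤n⇒m⊓n≡m (subst (via-0 ≤_) (via-0+2q≡via-k u q p) (m≤m+n via-0 (q + q)))))
            (via-0+q≡2k u q p)
    where
    via-0 = u + (u + (q + p)) + p
    via-0+2q≡via-k : ∀ u q p → u + (u + (q + p)) + p + (q + q) ≡ q + p + (u + (q + p)) + (u + q)
    via-0+2q≡via-k = solve-∀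
    via-0+q≡2k : ∀ u q p → u + (u + (q + p)) + p + q ≡ 2 * (u + (q + p))
    via-0+q≡2k = solve-∀

  tour-inside : ∀ {k u v} → u ≤ k → v ≤ k → tour 0 k u v + ∣ u - v ∣ ≡ 2 * k
  tour-inside {k} {u} {v} u≤k v≤k with ≤-total u v
  ... | inj₁ u≤v = tour-inside-≤ u≤v v≤k
  ... | inj₂ v≤u = trans (cong₂ _+_ (tour-sym 0 k u v) (∣-∣-comm u v)) (tour-inside-≤ v≤u u≤k)

  tourSum-0-k-[1+k] : ∀ k → 3 * tourSum 0 k (suc k) ≡ 3 * (suc k * suc k * k) + k * suc k * suc (k + k)
  tourSum-0-k-[1+k] k = +-cancelʳ-≡ (n * n * n) _ _ (begin
    3 * S + n * n * n         ≡⟨ cong (3 * S +_) (3*∑∣u-v∣+n≡n*n*n n) ⟨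
    3 * S + (3 * D + n)       ≡⟨ rearrange S D n ⟩
    3 * (S + D) + n           ≡⟨ cong (λ x → 3 * x + n) S+D≡n*[n*2k] ⟩
    3 * (n * (n * (2 * k))) + n ≡⟨ expand k ⟩
    3 * (n * n * k) + k * n * suc (k + k) + n * n * n ∎)
    where
    open ≡-Reasoning
    n = suc k
    S = tourSum 0 k n
    D = sumPairsBelow n (λ u v → ∣ u - v ∣)
    S+D≡n*[n*2k] : S + D ≡ n * (n * (2 * k))
    S+D≡n*[n*2k] = begin
      S + D  ≡⟨ sumPairsBelow-distrib-+ n (tour 0 k) (λ u v → ∣ u - v ∣) ⟨
      sumPairsBelow n (λ u v → tour 0 k u v + ∣ u - v ∣)
        ≡⟨ sumPairsBelow-cong n (λ u v u<n v<n → tour-inside (≤-pred u<n) (≤-pred v<n)) ⟩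
      sumBelow n (λ _ → sumBelow n (λ _ → 2 * k))
        ≡⟨ trans (sumBelow-cong n (λ _ _ → sumBelow-const n (2 * k))) (sumBelow-const n _) ⟩
      n * (n * (2 * k)) ∎
    rearrange : ∀ s d n → 3 * s + (3 * d + n) ≡ 3 * (s + d) + n
    rearrange = solve-∀
    expand : ∀ k → 3 * (suc k * (suc k * (2 * k))) + suc k
                 ≡ 3 * (suc k * suc k * k) + k * suc k * suc (k + k) + suc k * suc k * suc k
    expand = solve-∀

  tourSum-0-snoc : ∀ {k n} → k ≤ n → 3 * tourSum 0 k (suc n) ≡ 3 * tourSum 0 k n + 9 * (n * n) + 3 * n
  tourSum-0-snoc {k} {n} k≤n = begin
    3 * tourSum 0 k (suc n)
      ≡⟨ cong (3 *_) (sumPairsBelow-init-last n (tour 0 k)) ⟩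
    3 * (S + sumBelow n (tour 0 k n) + (sumBelow n (λ u → tour 0 k u n) + tour 0 k n n))
      ≡⟨ cong₂ (λ x y → 3 * (S + x + y)) lastRow (cong₂ _+_ lastColumn (tour-0-to n k≤n)) ⟩
    3 * (S + (t + n * n) + ((t + n * n) + (n + n)))
      ≡⟨ rearrange S t n ⟩
    3 * S + 3 * (2 * t + n) + 6 * (n * n) + 3 * n
      ≡⟨ cong (λ x → 3 * S + 3 * x + 6 * (n * n) + 3 * n) (2*sumBelow-id+n≡n*n n) ⟩
    3 * S + 3 * (n * n) + 6 * (n * n) + 3 * n
      ≡⟨ collect S n ⟩
    3 * S + 9 * (n * n) + 3 * n ∎
    where
    open ≡-Reasoning
    S = tourSum 0 k n
    t = sumBelow n (λ i → i)
    lastColumn : sumBelow n (λ u → tour 0 k u n) ≡ t + n * n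
    lastColumn = begin
      sumBelow n (λ u → tour 0 k u n)  ≡⟨ sumBelow-cong n (λ u _ → tour-0-to u k≤n) ⟩
      sumBelow n (λ u → u + n)         ≡⟨ sumBelow-distrib-+ n (λ u → u) (λ _ → n) ⟩
      t + sumBelow n (λ _ → n)         ≡⟨ cong (t +_) (sumBelow-const n n) ⟩
      t + n * n                        ∎
    lastRow : sumBelow n (tour 0 k n) ≡ t + n * n
    lastRow = trans (sumBelow-cong n (λ v _ → tour-sym 0 k n v)) lastColumn
    rearrange : ∀ s t n → 3 * (s + (t + n * n) + ((t + n * n) + (n + n)))
                        ≡ 3 * s + 3 * (2 * t + n) + 6 * (n * n) + 3 * n
    rearrange = solve-∀
    collect : ∀ s n → 3 * s + 3 * (n * n) + 6 * (n * n) + 3 * n ≡ 3 * s + 9 * (n * n) + 3 * n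
    collect = solve-∀

  tourSum-0 : ∀ k c → 3 * tourSum 0 k (suc (k + c))
                    ≡ 3 * (suc (k + c) * suc (k + c) * (k + c)) + k * suc k * suc (k + k)
  tourSum-0 k zero    rewrite +-identityʳ k = tourSum-0-k-[1+k] k
  tourSum-0 k (suc c) rewrite +-suc k c = begin
    3 * tourSum 0 k (suc n)                   ≡⟨ tourSum-0-snoc (≤-trans (m≤m+n k c) (n≤1+n _)) ⟩
    3 * tourSum 0 k n + 9 * (n * n) + 3 * n   ≡⟨ cong (λ x → x + 9 * (n * n) + 3 * n) (tourSum-0 k c) ⟩
    3 * (n * n * (k + c)) + K + 9 * (n * n) + 3 * n ≡⟨ grow (k + c) K ⟩
    3 * (suc n * suc n * n) + K               ∎
    where
    open ≡-Reasoning
    n = suc (k + c)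
    K = k * suc k * suc (k + k)
    grow : ∀ p K → 3 * (suc p * suc p * p) + K + 9 * (suc p * suc p) + 3 * suc p
                 ≡ 3 * (suc (suc p) * suc (suc p) * suc p) + K
    grow = solve-∀

  tourSum-shift : ∀ {m M} n → m ≤ M →
    tourSum (suc m) (suc M) (suc n) ≡ tourSum m M n + 2 * (suc n * suc M + distancesFrom M n)
  tourSum-shift {m} {M} n m≤M = begin
    tourSum (suc m) (suc M) (suc n)
      ≡⟨ sumPairsBelow-suc n (tour (suc m) (suc M)) ⟩
    tour (suc m) (suc M) 0 0 + sumBelow n (λ v → tour (suc m) (suc M) 0 (suc v))
      + (sumBelow n (λ u → tour (suc m) (suc M) (suc u) 0) + tourSum m M n)
      ≡⟨ cong₂ _+_ (cong₂ _+_ (tour-from-0 0 (s≤s m≤M)) firstRow) (cong (_+ tourSum m M n) firstColumn) ⟩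
    suc M + suc M + R + (R + tourSum m M n)
      ≡⟨ rearrange (tourSum m M n) n M (distancesFrom M n) ⟩
    tourSum m M n + 2 * (suc n * suc M + distancesFrom M n) ∎
    where
    open ≡-Reasoning
    R = n * suc M + distancesFrom M n
    firstRow : sumBelow n (λ v → tour (suc m) (suc M) 0 (suc v)) ≡ R
    firstRow = begin
      sumBelow n (λ v → tour (suc m) (suc M) 0 (suc v)) ≡⟨ sumBelow-cong n (λ v _ → tour-from-0 (suc v) (s≤s m≤M)) ⟩
      sumBelow n (λ v → suc M + ∣ M - v ∣)              ≡⟨ sumBelow-distrib-+ n (λ _ → suc M) (λ v → ∣ M - v ∣) ⟩
      sumBelow n (λ _ → suc M) + distancesFrom M n      ≡⟨ cong (_+ distancesFrom M n) (sumBelow-const n (suc M)) ⟩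
      R                                                 ∎
    firstColumn : sumBelow n (λ u → tour (suc m) (suc M) (suc u) 0) ≡ R
    firstColumn = trans (sumBelow-cong n (λ u _ → tour-sym (suc m) (suc M) (suc u) 0)) firstRow
    rearrange : ∀ s n M d → suc M + suc M + (n * suc M + d) + ((n * suc M + d) + s)
                          ≡ s + 2 * (suc n * suc M + d)
    rearrange = solve-∀

  -- Here a and b = k + 1 are the paper's a and b, and n = a + k + c + 1.
  tourSum-closed-form : ∀ a k c →
    6 * (a * c * suc (a + c + k + k)) + 3 * tourSum a (a + k) (suc (a + k + c))
      ≡ 3 * (suc (a + k + c) * suc (a + k + c) * (a + k + c)) + k * suc k * suc (k + k)
  tourSum-closed-form zero    k c = tourSum-0 k c
  tourSum-closed-form (suc a) k c = begin
    6 * (suc a * c * suc (suc a + c + k + k)) + 3 * tourSum (suc a) (suc M) (suc n)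
      ≡⟨ cong (λ x → 6 * (suc a * c * suc (suc a + c + k + k)) + 3 * x) (tourSum-shift n (m≤m+n a k)) ⟩
    6 * (suc a * c * suc (suc a + c + k + k)) + 3 * (S + 2 * (suc n * suc M + d))
      ≡⟨ rearrange a k c S d ⟩
    (6 * (a * c * suc (a + c + k + k)) + 3 * S) + 3 * (2 * d) + E
      ≡⟨ cong₂ (λ x y → x + 3 * y + E) (tourSum-closed-form a k c) (2*distancesFrom≡q*[1+q]+c*[1+c] M c) ⟩
    3 * (n * n * (a + k + c)) + K + 3 * (M * suc M + c * suc c) + E
      ≡⟨ grow a k c ⟩
    3 * (suc n * suc n * n) + K ∎
    where
    open ≡-Reasoning
    M = a + k
    n = suc (a + k + c)
    S = tourSum a M n
    d = distancesFrom M n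
    K = k * suc k * suc (k + k)
    E = 6 * c * (2 * a + c + 2 * k + 2) + 6 * (2 + a + k + c) * suc (a + k)
    rearrange : ∀ a k c s d →
      6 * (suc a * c * suc (suc a + c + k + k)) + 3 * (s + 2 * (suc (suc (a + k + c)) * suc (a + k) + d))
        ≡ (6 * (a * c * suc (a + c + k + k)) + 3 * s) + 3 * (2 * d)
          + (6 * c * (2 * a + c + 2 * k + 2) + 6 * (2 + a + k + c) * suc (a + k))
    rearrange = solve-∀
    grow : ∀ a k c →
      3 * (suc (a + k + c) * suc (a + k + c) * (a + k + c)) + k * suc k * suc (k + k)
        + 3 * ((a + k) * suc (a + k) + c * suc c)
        + (6 * c * (2 * a + c + 2 * k + 2) + 6 * (2 + a + k + c) * suc (a + k))
      ≡ 3 * (suc (suc (a + k + c)) * suc (suc (a + k + c)) * suc (a + k + c)) + k * suc k * suc (k + k)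
    grow = solve-∀

module ClosedForm where

  open import Data.Nat as ℕ using (suc)
  import Data.Nat.Properties as ℕ
  open import Data.Integer using (+_; _+_; _-_; _*_)
  open import Data.Integer.Properties using (pos-*)
  open import Data.Integer.Tactic.RingSolver using (solve-∀)
  open import Data.Product using (_,_)
  open import Relation.Binary.PropositionalEquality
  open Tours using (tourSum; tourSum-closed-form)

  pos-*³ : ∀ x y z → + (x ℕ.* y ℕ.* z) ≡ + x * + y * + z
  pos-*³ x y z = trans (pos-* (x ℕ.* y) z) (cong (_* + z) (pos-* x y))

  tourSum-closed-formℤ : ∀ {n m M} → m ℕ.≤ M → M ℕ.< n →
    let N = + n
        a = + m
        b = + M - + m + + 1
    in + 3 * + tourSum m M n
       ≡ + 3 * (N * N * N) - + 3 * (N * N) + b * (+ 2 * b - + 1) * (b - + 1) - + 6 * a * (N - b - a) * (N + b - + 1)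
  tourSum-closed-formℤ {n} {m} m≤M M<n with ℕ.m≤n⇒∃[o]m+o≡n m≤M
  ... | k , refl with ℕ.m≤n⇒∃[o]m+o≡n M<n
  ... | c , refl = begin
    + 3 * + S                ≡⟨ isolate (+ S) (+ m) (+ c) (+ k) ⟩
    (X + + 3 * + S) - X      ≡⟨ cong (_- X) (cong₂ _+_ castX (pos-* 3 S)) ⟨
    + (Xℕ ℕ.+ 3 ℕ.* S) - X   ≡⟨ cong (λ x → + x - X) (tourSum-closed-form m k c) ⟩
    + Fℕ - X                 ≡⟨ cong (_- X) castF ⟩
    F - X                    ≡⟨ expand (+ m) (+ c) (+ k) ⟩
    _ ∎
    where
    open ≡-Reasoning
    P = m ℕ.+ k ℕ.+ c
    S = tourSum m (m ℕ.+ k) (suc P)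
    Xℕ = 6 ℕ.* (m ℕ.* c ℕ.* suc (m ℕ.+ c ℕ.+ k ℕ.+ k))
    Fℕ = 3 ℕ.* (suc P ℕ.* suc P ℕ.* P) ℕ.+ k ℕ.* suc k ℕ.* suc (k ℕ.+ k)
    X = + 6 * (+ m * + c * (+ 1 + (+ m + + c + + k + + k)))
    F = + 3 * ((+ 1 + + P) * (+ 1 + + P) * + P) + + k * (+ 1 + + k) * (+ 1 + (+ k + + k))
    castX : + Xℕ ≡ X
    castX = trans (pos-* 6 (m ℕ.* c ℕ.* suc (m ℕ.+ c ℕ.+ k ℕ.+ k))) (cong (+ 6 *_) (pos-*³ m c _))
    castF : + Fℕ ≡ F
    castF = cong₂ _+_ (trans (pos-* 3 (suc P ℕ.* suc P ℕ.* P)) (cong (+ 3 *_) (pos-*³ (suc P) (suc P) P))) (pos-*³ k (suc k) _)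
    isolate : ∀ s a c k → + 3 * s ≡ (+ 6 * (a * c * (+ 1 + (a + c + k + k))) + + 3 * s) - + 6 * (a * c * (+ 1 + (a + c + k + k)))
    isolate = solve-∀
    expand : ∀ a c k → let P = a + k + c ; N = + 1 + P ; b = a + k - a + + 1 in
      + 3 * (N * N * P) + k * (+ 1 + k) * (+ 1 + (k + k)) - + 6 * (a * c * (+ 1 + (a + c + k + k)))
        ≡ + 3 * (N * N * N) - + 3 * (N * N) + b * (+ 2 * b - + 1) * (b - + 1) - + 6 * a * (N - b - a) * (N + b - + 1)
    expand = solve-∀

module PathWalks where

  open import Defs
  open import Data.Nat
  open import Data.Nat.Properties
  open import Data.Fin using (Fin; toℕ; fromℕ<)
  open import Data.Fin.Properties using (toℕ-injective; toℕ-fromℕ<; toℕ<n)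
  open import Data.Product using (Σ; _×_; _,_; proj₁; proj₂)
  open import Data.Sum using (_⊎_; inj₁; inj₂)
  open import Relation.Binary.PropositionalEquality
  open import Function.Base using (_∘_)
  open import Relation.Nullary using (yes; no)
  open Tours using (tour)

  ∣n-1+n∣≡1 : ∀ x → ∣ x - suc x ∣ ≡ 1
  ∣n-1+n∣≡1 zero    = refl
  ∣n-1+n∣≡1 (suc x) = ∣n-1+n∣≡1 x

  module _ {n : ℕ} where

    Adj-sym : {u w : Fin n} → Adj u w → Adj w u
    Adj-sym (inj₁ eq) = inj₂ eq
    Adj-sym (inj₂ eq) = inj₁ eq

    Adj⇒∣-∣≡1 : {u w : Fin n} → Adj u w → ∣ toℕ u - toℕ w ∣ ≡ 1
    Adj⇒∣-∣≡1 {u} (inj₁ eq) rewrite eq = ∣n-1+n∣≡1 (toℕ u)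
    Adj⇒∣-∣≡1 {w = w} (inj₂ eq) rewrite eq = trans (∣-∣-comm (suc (toℕ w)) (toℕ w)) (∣n-1+n∣≡1 (toℕ w))

    ∣-∣≤len : {u v : Fin n} (p : Walk u v) → ∣ toℕ u - toℕ v ∣ ≤ len p
    ∣-∣≤len (stay u) = ≤-reflexive (∣n-n∣≡0 (toℕ u))
    ∣-∣≤len {u} {v} (step {w = w} e p) = begin
      ∣ toℕ u - toℕ v ∣                      ≤⟨ ∣-∣-triangle (toℕ u) (toℕ w) (toℕ v) ⟩
      ∣ toℕ u - toℕ w ∣ + ∣ toℕ w - toℕ v ∣  ≡⟨ cong (_+ ∣ toℕ w - toℕ v ∣) (Adj⇒∣-∣≡1 e) ⟩
      suc ∣ toℕ w - toℕ v ∣                  ≤⟨ s≤s (∣-∣≤len p) ⟩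
      suc (len p)                            ∎
      where open ≤-Reasoning

    _++_ : {u w v : Fin n} → Walk u w → Walk w v → Walk u v
    stay _   ++ q = q
    step e p ++ q = step e (p ++ q)

    len-++ : {u w v : Fin n} (p : Walk u w) (q : Walk w v) → len (p ++ q) ≡ len p + len q
    len-++ (stay _)   q = refl
    len-++ (step e p) q = cong suc (len-++ p q)

    OnWalk-start : {u v : Fin n} (p : Walk u v) → OnWalk u p
    OnWalk-start (stay u)   = here-stay
    OnWalk-start (step e p) = here-step e p

    OnWalk-++ˡ : {x u w v : Fin n} (p : Walk u w) (q : Walk w v) → OnWalk x p → OnWalk x (p ++ q)
    OnWalk-++ˡ (stay _)   q here-stay         = OnWalk-start q
    OnWalk-++ˡ (step e p) q (here-step .e .p) = here-step e (p ++ q)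
    OnWalk-++ˡ (step e p) q (there .e o)      = there e (OnWalk-++ˡ p q o)

    OnWalk-++ʳ : {x u w v : Fin n} (p : Walk u w) (q : Walk w v) → OnWalk x q → OnWalk x (p ++ q)
    OnWalk-++ʳ (stay _)   q o = o
    OnWalk-++ʳ (step e p) q o = there e (OnWalk-++ʳ p q o)

    splitAt : {x u v : Fin n} (p : Walk u v) → OnWalk x p →
      Σ (Walk u x) λ p₁ → Σ (Walk x v) λ p₂ → (len p₁ + len p₂ ≡ len p) ×
        (∀ y → OnWalk y p → OnWalk y p₁ ⊎ OnWalk y p₂)
    splitAt (stay x)   here-stay         = stay x , stay x , refl , λ _ → inj₁
    splitAt (step e p) (here-step .e .p) = stay _ , step e p , refl , λ _ → inj₂
    splitAt (step e p) (there .e o) with splitAt p o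
    ... | p₁ , p₂ , len-eq , covers = step e p₁ , p₂ , cong suc len-eq , covers′
      where
      covers′ : ∀ y → OnWalk y (step e p) → OnWalk y (step e p₁) ⊎ OnWalk y p₂
      covers′ y (here-step .e .p) = inj₁ (here-step e p₁)
      covers′ y (there .e o′) with covers y o′
      ... | inj₁ o₁ = inj₁ (there e o₁)
      ... | inj₂ o₂ = inj₂ o₂

    reverse : {u v : Fin n} → Walk u v → Walk v u
    reverse (stay u)   = stay u
    reverse (step e p) = reverse p ++ step (Adj-sym e) (stay _)

    len-reverse : {u v : Fin n} (p : Walk u v) → len (reverse p) ≡ len p
    len-reverse (stay u)   = refl
    len-reverse (step e p) = trans (len-++ (reverse p) _) (trans (+-comm (len (reverse p)) 1) (cong suc (len-reverse p)))

    OnWalk-reverse : {x u v : Fin n} (p : Walk u v) → OnWalk x p → OnWalk x (reverse p)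
    OnWalk-reverse (stay _)   here-stay         = here-stay
    OnWalk-reverse (step e p) (here-step .e .p) = OnWalk-++ʳ (reverse p) _ (there (Adj-sym e) here-stay)
    OnWalk-reverse (step e p) (there .e o)      = OnWalk-++ˡ (reverse p) _ (OnWalk-reverse p o)

    ascent : ∀ d (i j : Fin n) → toℕ j ≡ d + toℕ i →
      Σ (Walk i j) λ p → len p ≡ d × (∀ z → toℕ i ≤ toℕ z → toℕ z ≤ toℕ j → OnWalk z p)
    ascent zero i j j≡i with toℕ-injective (sym j≡i)
    ... | refl = stay i , refl , visits
      where
      visits : ∀ z → toℕ i ≤ toℕ z → toℕ z ≤ toℕ i → OnWalk z (stay i)
      visits z i≤z z≤i with toℕ-injective (≤-antisym z≤i i≤z)
      ... | refl = here-stay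
    ascent (suc d) i j j≡1+d+i = step i→next rest , cong suc (proj₁ (proj₂ tail)) , visits
      where
      1+i<n : suc (toℕ i) < n
      1+i<n = <-≤-trans (s≤s (subst (toℕ i <_) (sym j≡1+d+i) (s≤s (m≤n+m (toℕ i) d)))) (toℕ<n j) 
      next : Fin n
      next = fromℕ< 1+i<n
      i→next : Adj i next
      i→next = inj₁ (toℕ-fromℕ< 1+i<n)
      tail = ascent d next j (trans j≡1+d+i (trans (sym (+-suc d (toℕ i))) (cong (d +_) (sym (toℕ-fromℕ< 1+i<n)))))
      rest = proj₁ tail
      visits : ∀ z → toℕ i ≤ toℕ z → toℕ z ≤ toℕ j → OnWalk z (step i→next rest)
      visits z i≤z z≤j with toℕ z ≟ toℕ i
      ... | yes z≡i rewrite toℕ-injective z≡i = here-step i→next rest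
      ... | no  z≢i = there i→next (proj₂ (proj₂ tail) z next≤z z≤j)
        where
        next≤z : toℕ next ≤ toℕ z
        next≤z = subst (_≤ toℕ z) (sym (toℕ-fromℕ< 1+i<n)) (≤∧≢⇒< i≤z (z≢i ∘ sym))

    geodesic : (u v : Fin n) → Σ (Walk u v) λ p → len p ≡ ∣ toℕ u - toℕ v ∣
    geodesic u v with ≤-total (toℕ u) (toℕ v)
    ... | inj₁ u≤v = proj₁ up , trans (proj₁ (proj₂ up)) (sym (m≤n⇒∣m-n∣≡n∸m u≤v))
      where up = ascent _ u v (sym (m∸n+n≡m u≤v))
    ... | inj₂ v≤u = reverse (proj₁ up) , trans (len-reverse _) (trans (proj₁ (proj₂ up)) (sym (m≤n⇒∣n-m∣≡n∸m v≤u)))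
      where up = ascent _ v u (sym (m∸n+n≡m v≤u))

    detour : {x y : Fin n} (p : Walk x y) (u v : Fin n) →
      Σ (Walk u v) λ q → (∀ z → OnWalk z p → OnWalk z q)
                       × len q ≡ ∣ toℕ u - toℕ x ∣ + len p + ∣ toℕ y - toℕ v ∣
    detour {x} {y} p u v = g₁ ++ (p ++ g₂) , (λ z o → OnWalk-++ʳ g₁ _ (OnWalk-++ˡ p g₂ o)) , length
      where
      open ≡-Reasoning
      g₁ = proj₁ (geodesic u x)
      g₂ = proj₁ (geodesic y v)
      length : len (g₁ ++ (p ++ g₂)) ≡ ∣ toℕ u - toℕ x ∣ + len p + ∣ toℕ y - toℕ v ∣
      length = begin
        len (g₁ ++ (p ++ g₂))      ≡⟨ len-++ g₁ _ ⟩
        len g₁ + len (p ++ g₂)     ≡⟨ cong (len g₁ +_) (len-++ p g₂) ⟩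
        len g₁ + (len p + len g₂)  ≡⟨ +-assoc (len g₁) _ _ ⟨
        len g₁ + len p + len g₂    ≡⟨ cong₂ (λ a b → a + len p + b) (proj₂ (geodesic u x)) (proj₂ (geodesic y v)) ⟩
        ∣ toℕ u - toℕ x ∣ + len p + ∣ toℕ y - toℕ v ∣ ∎

    tour≤len : {x y u v : Fin n} (p : Walk u v) → OnWalk x p → OnWalk y p →
               tour (toℕ x) (toℕ y) (toℕ u) (toℕ v) ≤ len p
    tour≤len {x} {y} {u} {v} p x∈p y∈p with splitAt p x∈p
    ... | p₁ , p₂ , len-eq , covers with covers y y∈p
    ... | inj₁ y∈p₁ with splitAt p₁ y∈p₁
    ...   | q₁ , q₂ , len-eq₁ , _ = ≤-trans (m⊓n≤n _ _) (begin
            ∣ toℕ u - toℕ y ∣ + ∣ toℕ y - toℕ x ∣ + ∣ toℕ x - toℕ v ∣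
              ≤⟨ +-mono-≤ (+-mono-≤ (∣-∣≤len q₁) (∣-∣≤len q₂)) (∣-∣≤len p₂) ⟩
            len q₁ + len q₂ + len p₂  ≡⟨ cong (_+ len p₂) len-eq₁ ⟩
            len p₁ + len p₂           ≡⟨ len-eq ⟩
            len p                     ∎)
      where open ≤-Reasoning
    tour≤len {x} {y} {u} {v} p x∈p y∈p | p₁ , p₂ , len-eq , covers | inj₂ y∈p₂ with splitAt p₂ y∈p₂
    ...   | q₁ , q₂ , len-eq₂ , _ = ≤-trans (m⊓n≤m _ _) (begin
            ∣ toℕ u - toℕ x ∣ + ∣ toℕ x - toℕ y ∣ + ∣ toℕ y - toℕ v ∣
              ≤⟨ +-mono-≤ (+-mono-≤ (∣-∣≤len p₁) (∣-∣≤len q₁)) (∣-∣≤len q₂) ⟩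
            len p₁ + len q₁ + len q₂    ≡⟨ +-assoc (len p₁) _ _ ⟩
            len p₁ + (len q₁ + len q₂)  ≡⟨ cong (len p₁ +_) len-eq₂ ⟩
            len p₁ + len p₂             ≡⟨ len-eq ⟩
            len p                       ∎)
      where open ≤-Reasoning

module ShortestTours where

  open import Defs
  open import Data.Nat
  open import Data.Nat.Properties
  open import Data.Fin using (Fin; toℕ; zero; suc)
  open import Data.Fin.Subset using (Subset; _∈_)
  open import Data.Product using (Σ; _×_; _,_; proj₁; proj₂)
  open import Data.Sum using (inj₁; inj₂)
  open import Relation.Binary.PropositionalEquality
  open Sums using (sumBelow; sumPairsBelow)
  open Tours using (tour; tourSum)
  open PathWalks

  IsRho-unique : ∀ {n} {A : Subset n} {u v k l} → IsRho A u v k → IsRho A u v l → k ≡ l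
  IsRho-unique {k = k} {l} ((p , visits-p , len-p) , k-min) ((q , visits-q , len-q) , l-min) =
    ≤-antisym (subst (k ≤_) len-q (k-min q visits-q)) (subst (l ≤_) len-p (l-min p visits-p))

  sumFin-toℕ : ∀ n (f : ℕ → ℕ) → sumFin n (λ i → f (toℕ i)) ≡ sumBelow n f
  sumFin-toℕ zero    f = refl
  sumFin-toℕ (suc n) f = cong (f 0 +_) (sumFin-toℕ n (λ i → f (suc i)))

  sumFin-cong : ∀ n {f g : Fin n → ℕ} → (∀ i → f i ≡ g i) → sumFin n f ≡ sumFin n g
  sumFin-cong zero    f≡g = refl
  sumFin-cong (suc n) f≡g = cong₂ _+_ (f≡g zero) (sumFin-cong n (λ i → f≡g (suc i)))

  sumPairs-toℕ : ∀ n (f : ℕ → ℕ → ℕ) → sumPairs n (λ u v → f (toℕ u) (toℕ v)) ≡ sumPairsBelow n f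
  sumPairs-toℕ n f = trans (sumFin-cong n (λ u → sumFin-toℕ n (f (toℕ u)))) (sumFin-toℕ n (λ u → sumBelow n (f u)))

  module _ {n : ℕ} (A : Subset n) {m M : Fin n} (m∈A : m ∈ A) (M∈A : M ∈ A)
           (m≤A : ∀ x → x ∈ A → toℕ m ≤ toℕ x) (A≤M : ∀ x → x ∈ A → toℕ x ≤ toℕ M) where

    ρ : Fin n → Fin n → ℕ
    ρ u v = tour (toℕ m) (toℕ M) (toℕ u) (toℕ v)

    m≤M : toℕ m ≤ toℕ M
    m≤M = m≤A M M∈A

    sweep : Σ (Walk m M) λ p → len p ≡ toℕ M ∸ toℕ m
                              × (∀ z → toℕ m ≤ toℕ z → toℕ z ≤ toℕ M → OnWalk z p)
    sweep = ascent _ m M (sym (m∸n+n≡m m≤M))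

    len-sweep : len (proj₁ sweep) ≡ ∣ toℕ m - toℕ M ∣
    len-sweep = trans (proj₁ (proj₂ sweep)) (sym (m≤n⇒∣m-n∣≡n∸m m≤M))

    sweep-visits : VisitsAll A (proj₁ sweep)
    sweep-visits x x∈A = proj₂ (proj₂ sweep) x (m≤A x x∈A) (A≤M x x∈A)

    ρ-attained : ∀ u v → Σ (Walk u v) λ p → VisitsAll A p × len p ≡ ρ u v
    ρ-attained u v with ⊓-sel (∣ toℕ u - toℕ m ∣ + ∣ toℕ m - toℕ M ∣ + ∣ toℕ M - toℕ v ∣)
                              (∣ toℕ u - toℕ M ∣ + ∣ toℕ M - toℕ m ∣ + ∣ toℕ m - toℕ v ∣)
    ... | inj₁ ρ≡via-m-first =
      let (p , covers , len-p) = detour (proj₁ sweep) u v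
      in p , (λ x x∈A → covers x (sweep-visits x x∈A))
           , trans len-p (trans (cong (λ l → ∣ toℕ u - toℕ m ∣ + l + ∣ toℕ M - toℕ v ∣) len-sweep) (sym ρ≡via-m-first))
    ... | inj₂ ρ≡via-M-first =
      let (p , covers , len-p) = detour (reverse (proj₁ sweep)) u v
      in p , (λ x x∈A → covers x (OnWalk-reverse (proj₁ sweep) (sweep-visits x x∈A)))
           , trans len-p (trans (cong (λ l → ∣ toℕ u - toℕ M ∣ + l + ∣ toℕ m - toℕ v ∣)
                                      (trans (len-reverse (proj₁ sweep)) (trans len-sweep (∣-∣-comm (toℕ m) (toℕ M)))))
                                (sym ρ≡via-M-first))

    ρ-IsRho : ∀ u v → IsRho A u v (ρ u v)
    ρ-IsRho u v = ρ-attained u v , λ p visits → tour≤len p (visits m m∈A) (visits M M∈A)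

    sumPairs≡tourSum : (ρ′ : Fin n → Fin n → ℕ) → (∀ u v → IsRho A u v (ρ′ u v)) →
                       sumPairs n ρ′ ≡ tourSum (toℕ m) (toℕ M) n
    sumPairs≡tourSum ρ′ ρ′-IsRho =
      trans (sumFin-cong n (λ u → sumFin-cong n (λ v → IsRho-unique (ρ′-IsRho u v) (ρ-IsRho u v))))
            (sumPairs-toℕ n (tour (toℕ m) (toℕ M)))

open import Defs
open import Data.Nat using (ℕ; _<_; _≤_)
open import Data.Fin using (Fin; toℕ)
open import Data.Fin.Subset using (Subset; _∈_)
open import Data.Integer using (ℤ; +_; _+_; _-_; _*_)
open import Data.Product using (Σ; _×_)
open import Relation.Binary.PropositionalEquality using (_≡_)
open import Data.Fin.Properties using (toℕ<n)
open import Data.Product using (_,_)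
open import Relation.Binary.PropositionalEquality using (trans; cong)
open ShortestTours
open ClosedForm using (tourSum-closed-formℤ)

proposition5p11 : (n : ℕ) → 2 < n → (A : Subset n)
    → (m M : Fin n) → m ∈ A → M ∈ A
    → (∀ x → x ∈ A → toℕ m ≤ toℕ x) → (∀ x → x ∈ A → toℕ x ≤ toℕ M)
    → let N = + n
          a = + toℕ m
          b = + toℕ M - + toℕ m + + 1
      in Σ (Fin n → Fin n → ℕ) (λ ρ → ∀ u v → IsRho A u v (ρ u v))
         × (∀ (ρ : Fin n → Fin n → ℕ) → (∀ u v → IsRho A u v (ρ u v))
            → + 3 * + sumPairs n ρ
              ≡ + 3 * (N * N * N) - + 3 * (N * N) + b * (+ 2 * b - + 1) * (b - + 1)
                - + 6 * a * (N - b - a) * (N + b - + 1))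
proposition5p11 n _ A m M m∈A M∈A m≤A A≤M =
  (ρ A m∈A M∈A m≤A A≤M , ρ-IsRho A m∈A M∈A m≤A A≤M) ,
  λ ρ′ ρ′-IsRho →
    trans (cong (λ s → + 3 * + s) (sumPairs≡tourSum A m∈A M∈A m≤A A≤M ρ′ ρ′-IsRho))
          (tourSum-closed-formℤ (m≤A M M∈A) (toℕ<n M))
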